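{- Let $A, B \subseteq \mathbb{Z}$ be finite sets with $|A| = a$ and $|B| = b$, and let $\ell \ge 0$ be an integer. Then $h(A,B,\ell) \le h([a],[b],\ell)$.
   Context: A diagonal is a line in $\mathbb{Z}^2$ of the form $\{(x,y) : x+y = z\}$ for some integer $z$. For finite $A, B \subseteq \mathbb{Z}$ and an integer $\ell \ge 0$, $h(A,B,\ell)$ denotes the largest number of points of a set $P \subseteq A \times B$ whose points lie on at most $\ell$ distinct diagonals. $[a] = \{1,\dots,a\}$. -}

module Defs where

open import Data.Nat using (ℕ; suc; _≤_)
open import Data.Integer using (ℤ; +_) renaming (_+_ to _+ℤ_)
open import Data.Product using (_×_; _,_; Σ; proj₁; proj₂)
open import Data.List using (List; length; map; upTo)
open import Data.List.Membership.Propositional using (_∈_)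
open import Data.List.Relation.Unary.All using (All)
open import Data.List.Relation.Unary.Unique.Propositional using (Unique)

⟦_⟧ : ℕ → List ℤ
⟦ a ⟧ = map (λ i → + suc i) (upTo a)

diag : ℤ × ℤ → ℤ
diag (x , y) = x +ℤ y

OnAtMostDiagonals : List (ℤ × ℤ) → ℕ → Set
OnAtMostDiagonals P ℓ = Σ (List ℤ) λ D → length D ≤ ℓ × All (λ p → diag p ∈ D) P

SubsetProd : List (ℤ × ℤ) → List ℤ → List ℤ → Set
SubsetProd P A B = All (λ p → proj₁ p ∈ A × proj₂ p ∈ B) P

-- "k ≤ h(A,B,ℓ)": some P ⊆ A × B on at most ℓ diagonals has exactly k points.
-- (h(A,B,ℓ) is the largest such k; it exists since A × B is finite.)
Achievable : List ℤ → List ℤ → ℕ → ℕ → Set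
Achievable A B ℓ k = Σ (List (ℤ × ℤ)) λ P →
  Unique P × SubsetProd P A B × OnAtMostDiagonals P ℓ × length P ≡ k
  where open import Relation.Binary.PropositionalEquality using (_≡_)

module Submission where

-- Both sides of the inequality are controlled by one explicit quantity,
--   bound ℓ a b = Σ_{i < min(a,b)} min(ℓ, a + b − 1 − 2i),
-- the number of points an a × b grid keeps when it is peeled into hooks of
-- lengths a + b − 1, a + b − 3, … and each hook keeps at most ℓ of them.
--
-- Upper bound (any A, B).  Let P ⊆ A × B lie on ℓ diagonals, x₀ the least
-- abscissa and y₀ the largest ordinate of P.  The points of P on the hook
-- x = x₀ or y = y₀ lie on pairwise distinct diagonals, so there are at most ℓ
-- of them, and at most a + b − 1 since the hook meets A × B in that many
-- points.  The other points lie in (A − x₀) × (B − y₀), so induction applies.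
--
-- Lower bound (A = [a], B = [b]).  Peel [a] × [b] into hooks.  The diagonals
-- of a hook with L points form an interval of length L, and all these
-- intervals have the same centre.  Keeping the grid points whose diagonal lies
-- in a window of m = min(ℓ, a + b) consecutive diagonals with that centre keeps
-- min(m, L) points of every hook, hence bound ℓ a b points on ≤ ℓ diagonals.

open import Defs
open import Data.Nat using (ℕ; zero; suc; _+_; _≤_; _<_; z≤n; s≤s; _⊓_; _∸_; _≤?_; _<?_)
import Data.Nat.Properties as ℕP
open import Data.Nat.Tactic.RingSolver using (solve-∀)
open import Data.Integer using (ℤ; +_) renaming (_+_ to _+ℤ_; _≤_ to _≤ℤ_)
import Data.Integer.Properties as ℤP
open import Algebra.Bundles using (AbelianGroup)
open import Algebra.Properties.Group (AbelianGroup.group ℤP.+-0-abelianGroup) using (∙-cancelˡ; ∙-cancelʳ)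
open import Data.List.Extrema ℤP.≤-totalOrder using (argmin; argmax; argmin-all; argmax-all; f[argmin]≤f[⊤]; f[argmin]≤f[xs]; f[⊥]≤f[argmax]; f[xs]≤f[argmax])
open import Data.List using (List; []; _∷_; length; map; filter; _++_)
open import Data.List.Properties using (length-++; length-map; filter-++; filter-notAll; filter-all; map-++; map-∘; map-cong)
open import Data.List.Membership.Propositional using (_∈_)
open import Data.List.Membership.Propositional.Properties using (∈-filter⁺; ∈-filter⁻; ∈-map⁺; ∈-map⁻; ∈-++⁺ˡ; ∈-++⁺ʳ; ∈-++⁻; ∈-upTo⁺)
import Data.List.Relation.Unary.All.Properties as AllP
open import Data.List.Relation.Binary.Subset.Propositional using (_⊆_)
open import Data.List.Relation.Unary.All as All using (All; []; _∷_)
import Data.List.Relation.Unary.Any as Any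
open import Data.List.Relation.Unary.Any using (here; there)
open import Data.List.Relation.Unary.AllPairs using ([]; _∷_)
open import Data.List.Relation.Unary.Unique.Propositional using (Unique)
import Data.List.Relation.Unary.Unique.Propositional.Properties as Unique
open import Data.Product using (Σ; _×_; _,_; proj₁; proj₂; swap)
open import Data.Sum using (_⊎_; inj₁; inj₂)
open import Data.Product.Properties using (≡-dec)
open import Data.Empty using (⊥-elim)
open import Function using (_∘_)
open import Relation.Binary.PropositionalEquality
open import Relation.Binary.Definitions using (DecidableEquality)
open import Relation.Nullary using (¬_; yes; no; ¬?)
open import Relation.Nullary.Decidable using (_⊎-dec_; _×-dec_)
open import Relation.Unary using (Decidable)
open import Relation.Unary.Properties using (∁?)

length-filter-split : {X : Set} {P : X → Set} (P? : Decidable P) (xs : List X) →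
  length (filter P? xs) + length (filter (∁? P?) xs) ≡ length xs
length-filter-split P? [] = refl
length-filter-split P? (x ∷ xs) with P? x
... | yes _ = cong suc (length-filter-split P? xs)
... | no _ = trans (ℕP.+-suc _ _) (cong suc (length-filter-split P? xs))

length-filter-map : {X Y : Set} {P : Y → Set} (P? : Decidable P) (f : X → Y) (xs : List X) →
  length (filter P? (map f xs)) ≡ length (filter (P? ∘ f) xs)
length-filter-map P? f [] = refl
length-filter-map P? f (x ∷ xs) with P? (f x)
... | yes _ = cong suc (length-filter-map P? f xs)
... | no _ = length-filter-map P? f xs

length-filter-++ : {X : Set} {P : X → Set} (P? : Decidable P) (xs ys : List X) →
  length (filter P? (xs ++ ys)) ≡ length (filter P? xs) + length (filter P? ys)
length-filter-++ P? xs ys = trans (cong length (filter-++ P? xs ys)) (length-++ (filter P? xs))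

module Counting {X : Set} (_≟_ : DecidableEquality X) where

  remove : X → List X → List X
  remove x = filter (λ y → ¬? (y ≟ x))

  ∈-remove : ∀ {x y xs} → y ∈ xs → ¬ y ≡ x → y ∈ remove x xs
  ∈-remove {x} = ∈-filter⁺ (λ z → ¬? (z ≟ x))

  remove-unique : ∀ {x xs} → Unique xs → Unique (remove x xs)
  remove-unique {x} = Unique.filter⁺ (λ z → ¬? (z ≟ x))

  length-remove-< : ∀ {x xs} → x ∈ xs → length (remove x xs) < length xs
  length-remove-< {x} {xs} x∈ = filter-notAll (λ y → ¬? (y ≟ x)) xs (Any.map (λ eq ne → ne (sym eq)) x∈)

  length-remove : ∀ {x xs} → Unique xs → x ∈ xs → suc (length (remove x xs)) ≡ length xs
  length-remove {x} {y ∷ xs} (y∉ ∷ _) (here refl) with x ≟ x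
  ... | yes _ = cong suc (cong length (filter-all (λ z → ¬? (z ≟ x)) (All.map (λ ne eq → ne (sym eq)) y∉)))
  ... | no x≢x = ⊥-elim (x≢x refl)
  length-remove {x} {y ∷ xs} (y∉ ∷ u) (there x∈) with y ≟ x
  ... | yes refl = ⊥-elim (All.lookup y∉ x∈ refl)
  ... | no _ = cong suc (length-remove u x∈)

  length-≤-injection : {W : Set} (f : W → X) (ws : List W) (ys : List X) → Unique ws →
    (∀ {v w} → v ∈ ws → w ∈ ws → f v ≡ f w → v ≡ w) →
    All (λ w → f w ∈ ys) ws → length ws ≤ length ys
  length-≤-injection f [] ys _ _ _ = z≤n
  length-≤-injection f (w ∷ ws) ys (w∉ ∷ u) inj (fw∈ ∷ fws∈) =
    ℕP.≤-trans (s≤s rest) (length-remove-< fw∈)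
    where
    avoids-fw : All (λ v → f v ∈ remove (f w) ys) ws
    avoids-fw = All.tabulate λ v∈ → ∈-remove (All.lookup fws∈ v∈)
      λ eq → All.lookup w∉ v∈ (inj (here refl) (there v∈) (sym eq))
    rest : length ws ≤ length (remove (f w) ys)
    rest = length-≤-injection f ws (remove (f w) ys) u (λ v∈ w∈ → inj (there v∈) (there w∈)) avoids-fw

  length-≤-⊆ : {xs ys : List X} → Unique xs → xs ⊆ ys → length xs ≤ length ys
  length-≤-⊆ {xs} {ys} u xs⊆ys = length-≤-injection (λ x → x) xs ys u (λ _ _ e → e) (All.tabulate xs⊆ys)

module Cℤ = Counting ℤP._≟_
module Cℤ² = Counting (≡-dec ℤP._≟_ ℤP._≟_)
module Cℕ = Counting ℕP._≟_
open Cℤ using (remove; ∈-remove; remove-unique)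

bound : ℕ → ℕ → ℕ → ℕ
bound ℓ zero b = 0
bound ℓ (suc a) zero = 0
bound ℓ (suc a) (suc b) = ℓ ⊓ suc (a + b) + bound ℓ a b

bound-step : ∀ {ℓ h r} a b → h ≤ ℓ → h ≤ suc b + a → r ≤ bound ℓ a b → h + r ≤ bound ℓ (suc a) (suc b)
bound-step a b h≤ℓ h≤size r≤ =
  ℕP.+-mono-≤ (ℕP.⊓-glb h≤ℓ (ℕP.≤-trans h≤size (ℕP.≤-reflexive (cong suc (ℕP.+-comm b a))))) r≤

+-≡-≤ : ∀ {i j k l} → i ≤ℤ j → k ≤ℤ l → i +ℤ k ≡ j +ℤ l → i ≡ j × k ≡ l
+-≡-≤ {i} {j} {k} {l} i≤j k≤l i+k≡j+l = i≡j , k≡l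
  where
  k≡l : k ≡ l
  k≡l = ∙-cancelˡ i k l (ℤP.≤-antisym (ℤP.+-monoʳ-≤ i k≤l)
          (subst (i +ℤ l ≤ℤ_) (sym i+k≡j+l) (ℤP.+-monoˡ-≤ l i≤j)))
  i≡j : i ≡ j
  i≡j = ∙-cancelʳ k i j (trans i+k≡j+l (cong (j +ℤ_) (sym k≡l)))

InCorner : ℤ → ℤ → ℤ × ℤ → Set
InCorner x₀ y₀ (x , y) = x₀ ≤ℤ x × y ≤ℤ y₀

OnHook : ℤ → ℤ → ℤ × ℤ → Set
OnHook x₀ y₀ (x , y) = x ≡ x₀ ⊎ y ≡ y₀

onHook? : ∀ x₀ y₀ → Decidable (OnHook x₀ y₀)
onHook? x₀ y₀ (x , y) = (x ℤP.≟ x₀) ⊎-dec (y ℤP.≟ y₀)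

hook-diag-injective : ∀ {x₀ y₀ q r} → InCorner x₀ y₀ q → InCorner x₀ y₀ r →
  OnHook x₀ y₀ q → OnHook x₀ y₀ r → diag q ≡ diag r → q ≡ r
hook-diag-injective {x₀} _ _ (inj₁ refl) (inj₁ refl) e = cong (x₀ ,_) (∙-cancelˡ x₀ _ _ e)
hook-diag-injective {y₀ = y₀} _ _ (inj₂ refl) (inj₂ refl) e = cong (_, y₀) (∙-cancelʳ y₀ _ _ e)
hook-diag-injective (_ , y≤y₀) (x₀≤x , _) (inj₁ refl) (inj₂ refl) e
  with refl , refl ← +-≡-≤ x₀≤x y≤y₀ e = refl
hook-diag-injective (x₀≤x , _) (_ , y≤y₀) (inj₂ refl) (inj₁ refl) e
  with refl , refl ← +-≡-≤ x₀≤x y≤y₀ (sym e) = refl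

leftmost : (p : ℤ × ℤ) (ps : List (ℤ × ℤ)) →
  argmin proj₁ p ps ∈ p ∷ ps × All (λ q → proj₁ (argmin proj₁ p ps) ≤ℤ proj₁ q) (p ∷ ps)
leftmost p ps = argmin-all proj₁ (here refl) (All.tabulate there)
              , f[argmin]≤f[⊤] {f = proj₁} p ps ∷ f[argmin]≤f[xs] {f = proj₁} p ps

topmost : (p : ℤ × ℤ) (ps : List (ℤ × ℤ)) →
  argmax proj₂ p ps ∈ p ∷ ps × All (λ q → proj₂ q ≤ℤ proj₂ (argmax proj₂ p ps)) (p ∷ ps)
topmost p ps = argmax-all proj₂ (here refl) (All.tabulate there)
             , f[⊥]≤f[argmax] {f = proj₂} p ps ∷ f[xs]≤f[argmax] {f = proj₂} p ps

hook-≤-diagonals : ∀ {x₀ y₀ P ℓ} → Unique P → All (InCorner x₀ y₀) P → OnAtMostDiagonals P ℓ →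
  length (filter (onHook? x₀ y₀) P) ≤ ℓ
hook-≤-diagonals {x₀} {y₀} {P} uP corner (D , |D|≤ℓ , onD) =
  ℕP.≤-trans (Cℤ.length-≤-injection diag (filter (onHook? x₀ y₀) P) D
               (Unique.filter⁺ (onHook? x₀ y₀) uP) injective (AllP.filter⁺ (onHook? x₀ y₀) onD))
             |D|≤ℓ
  where
  injective : ∀ {q r} → q ∈ filter (onHook? x₀ y₀) P → r ∈ filter (onHook? x₀ y₀) P → diag q ≡ diag r → q ≡ r
  injective q∈ r∈
    with q∈P , q-on ← ∈-filter⁻ (onHook? x₀ y₀) q∈ | r∈P , r-on ← ∈-filter⁻ (onHook? x₀ y₀) r∈ =
    hook-diag-injective (All.lookup corner q∈P) (All.lookup corner r∈P) q-on r-on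

-- A hook meets A × B in at most |B| + |A − x₀| points: its column meets
-- {x₀} × B, the rest of its row meets (A − x₀) × {y₀}.
hook-≤-lines : ∀ {x₀ y₀ P A B} → Unique P → SubsetProd P A B →
  length (filter (onHook? x₀ y₀) P) ≤ length B + length (remove x₀ A)
hook-≤-lines {x₀} {y₀} {P} {A} {B} uP sub =
  ℕP.≤-trans (Cℤ².length-≤-⊆ (Unique.filter⁺ (onHook? x₀ y₀) uP) on-lines) (ℕP.≤-reflexive |lines|)
  where
  lines : List (ℤ × ℤ)
  lines = map (x₀ ,_) B ++ map (_, y₀) (remove x₀ A)
  |lines| : length lines ≡ length B + length (remove x₀ A)
  |lines| = trans (length-++ (map (x₀ ,_) B)) (cong₂ _+_ (length-map _ B) (length-map _ (remove x₀ A)))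
  on-lines : filter (onHook? x₀ y₀) P ⊆ lines
  on-lines {x , y} q∈ with ∈-filter⁻ (onHook? x₀ y₀) q∈ | x ℤP.≟ x₀
  ... | q∈P , _ | yes refl = ∈-++⁺ˡ (∈-map⁺ (x₀ ,_) (proj₂ (All.lookup sub q∈P)))
  ... | q∈P , inj₂ refl | no x≢x₀ =
    ∈-++⁺ʳ (map (x₀ ,_) B) (∈-map⁺ (_, y₀) (∈-remove (proj₁ (All.lookup sub q∈P)) x≢x₀))
  ... | _ , inj₁ x≡x₀ | no x≢x₀ = ⊥-elim (x≢x₀ x≡x₀)

off-hook-⊆ : ∀ {x₀ y₀ P A B} → SubsetProd P A B →
  SubsetProd (filter (∁? (onHook? x₀ y₀)) P) (remove x₀ A) (remove y₀ B)
off-hook-⊆ {x₀} {y₀} sub = All.tabulate λ q∈ →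
  let q∈P , off = ∈-filter⁻ (∁? (onHook? x₀ y₀)) q∈
      x∈A , y∈B = All.lookup sub q∈P
  in ∈-remove x∈A (off ∘ inj₁) , ∈-remove y∈B (off ∘ inj₂)

-- Each step removes the hook at the corner of P
-- (least abscissa, largest ordinate); n = |A| is the recursion measure.
upper-bound : ∀ ℓ n (A B : List ℤ) (P : List (ℤ × ℤ)) → length A ≡ n →
  Unique A → Unique B → Unique P → SubsetProd P A B → OnAtMostDiagonals P ℓ →
  length P ≤ bound ℓ (length A) (length B)
upper-bound ℓ n A B [] _ _ _ _ _ _ = z≤n
upper-bound ℓ zero [] B (p ∷ ps) _ _ _ _ ((() , _) ∷ _) _
upper-bound ℓ zero (_ ∷ _) B (p ∷ ps) () _ _ _ _ _
upper-bound ℓ (suc n) A B (p ∷ ps) |A|≡1+n uA uB uP sub (D , |D|≤ℓ , onD) = begin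
    length P                                      ≡⟨ sym (length-filter-split (onHook? x₀ y₀) P) ⟩
    length H + length R                           ≤⟨ bound-step (length A′) (length B′) H≤ℓ H≤size R≤ ⟩
    bound ℓ (suc (length A′)) (suc (length B′))   ≡⟨ cong₂ (bound ℓ) |A′| |B′| ⟩
    bound ℓ (length A) (length B)                 ∎
  where
  open ℕP.≤-Reasoning
  P = p ∷ ps
  x₀ = proj₁ (argmin proj₁ p ps)
  y₀ = proj₂ (argmax proj₂ p ps)
  A′ = remove x₀ A
  B′ = remove y₀ B
  H = filter (onHook? x₀ y₀) P
  R = filter (∁? (onHook? x₀ y₀)) P
  corner : All (InCorner x₀ y₀) P
  corner = All.zip (proj₂ (leftmost p ps) , proj₂ (topmost p ps))
  |A′| : suc (length A′) ≡ length A
  |A′| = Cℤ.length-remove uA (proj₁ (All.lookup sub (proj₁ (leftmost p ps))))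
  |B′| : suc (length B′) ≡ length B
  |B′| = Cℤ.length-remove uB (proj₂ (All.lookup sub (proj₁ (topmost p ps))))
  H≤ℓ : length H ≤ ℓ
  H≤ℓ = hook-≤-diagonals uP corner (D , |D|≤ℓ , onD)
  H≤size : length H ≤ suc (length B′) + length A′
  H≤size = subst (λ b → length H ≤ b + length A′) (sym |B′|) (hook-≤-lines uP sub)
  R≤ : length R ≤ bound ℓ (length A′) (length B′)
  R≤ = upper-bound ℓ n A′ B′ R (ℕP.suc-injective (trans |A′| |A|≡1+n))
         (remove-unique uA) (remove-unique uB) (Unique.filter⁺ (∁? (onHook? x₀ y₀)) uP)
         (off-hook-⊆ sub) (D , |D|≤ℓ , AllP.filter⁺ (∁? (onHook? x₀ y₀)) onD)

interval : ℕ → ℕ → List ℕ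
interval k zero = []
interval k (suc n) = k ∷ interval (suc k) n

length-interval : ∀ k n → length (interval k n) ≡ n
length-interval k zero = refl
length-interval k (suc n) = cong suc (length-interval (suc k) n)

∈-interval⁻ : ∀ {s} k n → s ∈ interval k n → k ≤ s × s < k + n
∈-interval⁻ k (suc n) (here refl) = ℕP.≤-refl , ℕP.m<m+n k (s≤s z≤n)
∈-interval⁻ {s} k (suc n) (there s∈) with k<s , s<k+n ← ∈-interval⁻ (suc k) n s∈ =
  ℕP.<⇒≤ k<s , subst (s <_) (sym (ℕP.+-suc k n)) s<k+n

∈-interval⁺ : ∀ {s} k n → k ≤ s → s < k + n → s ∈ interval k n
∈-interval⁺ {s} k zero k≤s s<k+0 = ⊥-elim (ℕP.<⇒≱ (subst (s <_) (ℕP.+-identityʳ k) s<k+0) k≤s)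
∈-interval⁺ {s} k (suc n) k≤s s<k+n with k ℕP.≟ s
... | yes refl = here refl
... | no k≢s = there (∈-interval⁺ (suc k) n (ℕP.≤∧≢⇒< k≤s k≢s) (subst (s <_) (ℕP.+-suc k n) s<k+n))

interval-unique : ∀ k n → Unique (interval k n)
interval-unique k zero = []
interval-unique k (suc n) =
  All.tabulate (λ s∈ k≡s → ℕP.<-irrefl k≡s (proj₁ (∈-interval⁻ (suc k) n s∈))) ∷ interval-unique (suc k) n

interval-++ : ∀ k m n → interval k (m + n) ≡ interval k m ++ interval (k + m) n
interval-++ k zero n = cong (λ j → interval j n) (sym (ℕP.+-identityʳ k))
interval-++ k (suc m) n =
  cong (k ∷_) (trans (interval-++ (suc k) m n)
                     (cong (λ j → interval (suc k) m ++ interval j n) (sym (ℕP.+-suc k m))))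

interval-shift : ∀ d k n → map (_+ d) (interval k n) ≡ interval (k + d) n
interval-shift d k zero = refl
interval-shift d k (suc n) = cong (k + d ∷_) (interval-shift d (suc k) n)

-- Centres of intervals are compared through twiceMid k n = k + k + n, which is
-- twice the midpoint of [k, k + n) plus one; two centres are close when these
-- numbers differ by at most one.
twiceMid : ℕ → ℕ → ℕ
twiceMid k n = k + k + n

Close : ℕ → ℕ → Set
Close u v = u ≤ suc v × v ≤ suc u

half-≤ : ∀ x y → x + x ≤ suc (y + y) → x ≤ y
half-≤ zero y _ = z≤n
half-≤ (suc x) zero (s≤s le) = ⊥-elim (ℕP.m+1+n≢0 x (ℕP.n≤0⇒n≡0 le))
half-≤ (suc x) (suc y) (s≤s le) rewrite ℕP.+-suc x x | ℕP.+-suc y y = s≤s (half-≤ x y (ℕP.≤-pred le))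

centred-⊆ : ∀ {c m k n} → m ≤ n → Close (twiceMid c m) (twiceMid k n) → interval c m ⊆ interval k n
centred-⊆ {c} {m} {k} {n} m≤n (lo , hi) {s} s∈ with c≤s , s<c+m ← ∈-interval⁻ c m s∈ =
  ∈-interval⁺ k n (ℕP.≤-trans k≤c c≤s) (ℕP.<-≤-trans s<c+m c+m≤k+n)
  where
  doubled : ∀ x y → (x + y) + (x + y) ≡ x + x + y + y
  doubled = solve-∀
  k≤c : k ≤ c
  k≤c = half-≤ k c (ℕP.+-cancelʳ-≤ n (k + k) (suc (c + c))
          (ℕP.≤-trans hi (s≤s (ℕP.+-monoʳ-≤ (c + c) m≤n))))
  c+m≤k+n : c + m ≤ k + n
  c+m≤k+n = half-≤ (c + m) (k + n) (begin
    (c + m) + (c + m)   ≡⟨ doubled c m ⟩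
    c + c + m + m       ≤⟨ ℕP.+-mono-≤ lo m≤n ⟩
    suc (k + k + n + n) ≡⟨ cong suc (sym (doubled k n)) ⟩
    suc ((k + n) + (k + n)) ∎)
    where open ℕP.≤-Reasoning

InWindow : ℕ → ℕ → ℕ → Set
InWindow c m s = c ≤ s × s < c + m

inWindow? : ∀ c m → Decidable (InWindow c m)
inWindow? c m s = (c ≤? s) ×-dec (s <? c + m)

window-count : ∀ {c m k L} → Close (twiceMid c m) (twiceMid k L) →
  m ⊓ L ≤ length (filter (inWindow? c m) (interval k L))
window-count {c} {m} {k} {L} close with ℕP.≤-total m L
... | inj₁ m≤L = begin
    m ⊓ L                   ≡⟨ ℕP.m≤n⇒m⊓n≡m m≤L ⟩
    m                       ≡⟨ sym (length-interval c m) ⟩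
    length (interval c m)   ≤⟨ Cℕ.length-≤-⊆ (interval-unique c m) window⊆ ⟩
    length (filter (inWindow? c m) (interval k L)) ∎
  where
  open ℕP.≤-Reasoning
  window⊆ : interval c m ⊆ filter (inWindow? c m) (interval k L)
  window⊆ s∈ = ∈-filter⁺ (inWindow? c m) (centred-⊆ m≤L close s∈) (∈-interval⁻ c m s∈)
... | inj₂ L≤m = begin
    m ⊓ L                   ≡⟨ ℕP.m≥n⇒m⊓n≡n L≤m ⟩
    L                       ≡⟨ sym (length-interval k L) ⟩
    length (interval k L)   ≤⟨ Cℕ.length-≤-⊆ (interval-unique k L) interval⊆ ⟩
    length (filter (inWindow? c m) (interval k L)) ∎
  where
  open ℕP.≤-Reasoning
  interval⊆ : interval k L ⊆ filter (inWindow? c m) (interval k L)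
  interval⊆ s∈ = ∈-filter⁺ (inWindow? c m) s∈ (∈-interval⁻ c m (centred-⊆ L≤m (swap close) s∈))

diagℕ : ℕ × ℕ → ℕ
diagℕ (x , y) = x + y

hook : ℕ → ℕ → ℕ → List (ℕ × ℕ)
hook t a b = map (suc t ,_) (interval 1 (suc b)) ++ map (_, suc b) (interval (2 + t) a)

-- grid t a b lists the rectangle [t + 1, t + a] × [1, b], peeled into hooks.
grid : ℕ → ℕ → ℕ → List (ℕ × ℕ)
grid t zero b = []
grid t (suc a) zero = []
grid t (suc a) (suc b) = hook t a b ++ grid (suc t) a b

hook-diagonals : ∀ t a b → map diagℕ (hook t a b) ≡ interval (2 + t) (suc b + a)
hook-diagonals t a b = begin
    map diagℕ (column ++ row)                             ≡⟨ map-++ diagℕ column row ⟩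
    map diagℕ column ++ map diagℕ row                     ≡⟨ cong₂ _++_ column-diagonals row-diagonals ⟩
    interval (2 + t) (suc b) ++ interval (2 + t + suc b) a ≡⟨ sym (interval-++ (2 + t) (suc b) a) ⟩
    interval (2 + t) (suc b + a)                          ∎
  where
  open ≡-Reasoning
  column row : List (ℕ × ℕ)
  column = map (suc t ,_) (interval 1 (suc b))
  row = map (_, suc b) (interval (2 + t) a)
  column-diagonals : map diagℕ column ≡ interval (2 + t) (suc b)
  column-diagonals = begin
    map diagℕ column                       ≡⟨ sym (map-∘ (interval 1 (suc b))) ⟩
    map (λ j → suc t + j) (interval 1 (suc b)) ≡⟨ map-cong (ℕP.+-comm (suc t)) (interval 1 (suc b)) ⟩
    map (_+ suc t) (interval 1 (suc b))    ≡⟨ interval-shift (suc t) 1 (suc b) ⟩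
    interval (2 + t) (suc b)               ∎
  row-diagonals : map diagℕ row ≡ interval (2 + t + suc b) a
  row-diagonals = trans (sym (map-∘ (interval (2 + t) a))) (interval-shift (suc b) (2 + t) a)

InBox : ℕ → ℕ → ℕ → ℕ × ℕ → Set
InBox t a b (x , y) = (t < x × x ≤ t + a) × (0 < y × y ≤ b)

hook-member : ∀ {t a b p} → p ∈ hook t a b →
  InBox t (suc a) (suc b) p × (proj₁ p ≡ suc t ⊎ proj₂ p ≡ suc b)
hook-member {t} {a} {b} p∈ with ∈-++⁻ (map (suc t ,_) (interval 1 (suc b))) p∈
... | inj₁ c∈ with j , j∈ , refl ← ∈-map⁻ (suc t ,_) c∈ with 1≤j , j<2+b ← ∈-interval⁻ 1 (suc b) j∈ =
  ((ℕP.≤-refl , ℕP.m<m+n t (s≤s z≤n)) , (1≤j , ℕP.≤-pred j<2+b)) , inj₁ refl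
... | inj₂ r∈ with i , i∈ , refl ← ∈-map⁻ (_, suc b) r∈ with 2+t≤i , i<2+t+a ← ∈-interval⁻ (2 + t) a i∈ =
  ((ℕP.<⇒≤ 2+t≤i , subst (i ≤_) (sym (ℕP.+-suc t a)) (ℕP.≤-pred i<2+t+a)) , (s≤s z≤n , ℕP.≤-refl)) , inj₂ refl

grid-in-box : ∀ t a b {p} → p ∈ grid t a b → InBox t a b p
grid-in-box t (suc a) (suc b) {x , y} p∈ with ∈-++⁻ (hook t a b) p∈
... | inj₁ h∈ = proj₁ (hook-member h∈)
... | inj₂ g∈ with (t<x , x≤t+a) , (0<y , y≤b) ← grid-in-box (suc t) a b g∈ =
  (ℕP.<⇒≤ t<x , subst (x ≤_) (sym (ℕP.+-suc t a)) x≤t+a) , (0<y , ℕP.m≤n⇒m≤1+n y≤b)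

grid-unique : ∀ t a b → Unique (grid t a b)
grid-unique t zero b = []
grid-unique t (suc a) zero = []
grid-unique t (suc a) (suc b) = Unique.++⁺ hook-unique (grid-unique (suc t) a b) hook-grid-disjoint
  where
  column-row-disjoint : ∀ {p} → ¬ (p ∈ map (suc t ,_) (interval 1 (suc b)) × p ∈ map (_, suc b) (interval (2 + t) a))
  column-row-disjoint (c∈ , r∈)
    with _ , _ , refl ← ∈-map⁻ (suc t ,_) c∈ | i , i∈ , e ← ∈-map⁻ (_, suc b) r∈ =
    ℕP.<-irrefl (cong proj₁ e) (proj₁ (∈-interval⁻ (2 + t) a i∈))
  hook-unique : Unique (hook t a b)
  hook-unique = Unique.++⁺ (Unique.map⁺ (cong proj₂) (interval-unique 1 (suc b)))
                           (Unique.map⁺ (cong proj₁) (interval-unique (2 + t) a)) column-row-disjoint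
  hook-grid-disjoint : ∀ {p} → ¬ (p ∈ hook t a b × p ∈ grid (suc t) a b)
  hook-grid-disjoint (h∈ , g∈) with proj₂ (hook-member h∈) | grid-in-box (suc t) a b g∈
  ... | inj₁ x≡1+t | (1+t<x , _) , _ = ℕP.<-irrefl (sym x≡1+t) 1+t<x
  ... | inj₂ y≡1+b | _ , (_ , y≤b) = ℕP.<-irrefl y≡1+b (s≤s y≤b)

inStrip? : ∀ c m → Decidable (InWindow c m ∘ diagℕ)
inStrip? c m p = inWindow? c m (diagℕ p)

-- All hooks of grid t a b have diagonal intervals centred at t + t + a + b + 3
-- (in twiceMid units).  A window centred there keeps min(m, L) points of each
-- hook of length L, which adds up to bound m a b.
strip-count : ∀ {c m} t a b → Close (twiceMid c m) (t + t + a + b + 3) →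
  bound m a b ≤ length (filter (inStrip? c m) (grid t a b))
strip-count t zero b _ = z≤n
strip-count t (suc a) zero _ = z≤n
strip-count {c} {m} t (suc a) (suc b) close = begin
    m ⊓ suc (a + b) + bound m a b
      ≤⟨ ℕP.+-mono-≤ hook-count (strip-count (suc t) a b (subst (Close (twiceMid c m)) (next-mid t a b) close)) ⟩
    length (filter (inStrip? c m) (hook t a b)) + length (filter (inStrip? c m) (grid (suc t) a b))
      ≡⟨ sym (length-filter-++ (inStrip? c m) (hook t a b) (grid (suc t) a b)) ⟩
    length (filter (inStrip? c m) (grid t (suc a) (suc b))) ∎
  where
  open ℕP.≤-Reasoning
  hook-mid : ∀ t a b → (2 + t) + (2 + t) + (suc b + a) ≡ t + t + suc a + suc b + 3
  hook-mid = solve-∀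
  next-mid : ∀ t a b → t + t + suc a + suc b + 3 ≡ suc t + suc t + a + b + 3
  next-mid = solve-∀
  hook-count : m ⊓ suc (a + b) ≤ length (filter (inStrip? c m) (hook t a b))
  hook-count = begin
    m ⊓ suc (a + b)
      ≡⟨ cong (λ L → m ⊓ suc L) (ℕP.+-comm a b) ⟩
    m ⊓ (suc b + a)
      ≤⟨ window-count {c} {m} {2 + t} (subst (Close (twiceMid c m)) (sym (hook-mid t a b)) close) ⟩
    length (filter (inWindow? c m) (interval (2 + t) (suc b + a)))
      ≡⟨ cong (length ∘ filter (inWindow? c m)) (sym (hook-diagonals t a b)) ⟩
    length (filter (inWindow? c m) (map diagℕ (hook t a b)))
      ≡⟨ length-filter-map (inWindow? c m) diagℕ (hook t a b) ⟩
    length (filter (inStrip? c m) (hook t a b)) ∎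

bound-⊓ : ∀ ℓ S a b → a + b ≤ S → bound ℓ a b ≤ bound (ℓ ⊓ S) a b
bound-⊓ ℓ S zero b _ = z≤n
bound-⊓ ℓ S (suc a) zero _ = z≤n
bound-⊓ ℓ S (suc a) (suc b) a+b+2≤S = ℕP.+-mono-≤ hook≤ (bound-⊓ ℓ S a b (ℕP.≤-trans a+b≤a+b+2 a+b+2≤S))
  where
  a+b≤a+b+2 : a + b ≤ suc a + suc b
  a+b≤a+b+2 = ℕP.+-mono-≤ (ℕP.n≤1+n a) (ℕP.n≤1+n b)
  a+b+1≤S : suc (a + b) ≤ S
  a+b+1≤S = ℕP.≤-trans (s≤s (ℕP.+-monoʳ-≤ a (ℕP.n≤1+n b))) a+b+2≤S
  hook≤ : ℓ ⊓ suc (a + b) ≤ (ℓ ⊓ S) ⊓ suc (a + b)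
  hook≤ = ℕP.⊓-glb (ℕP.⊓-glb (ℕP.m⊓n≤m ℓ _) (ℕP.≤-trans (ℕP.m⊓n≤n ℓ _) a+b+1≤S)) (ℕP.m⊓n≤n ℓ _)

halve : ∀ n → Σ ℕ λ c → c + c ≤ n × n ≤ suc (c + c)
halve zero = 0 , z≤n , z≤n
halve (suc zero) = 0 , z≤n , s≤s z≤n
halve (suc (suc n)) with c , lo , hi ← halve n =
  suc c , subst (_≤ 2 + n) (sym 2c+2) (s≤s (s≤s lo)) , subst (2 + n ≤_) (cong suc (sym 2c+2)) (s≤s (s≤s hi))
  where
  2c+2 : suc c + suc c ≡ 2 + (c + c)
  2c+2 = cong suc (ℕP.+-suc c c)

centred-window : ∀ m T → m ≤ T → Σ ℕ λ c → Close (twiceMid c m) T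
centred-window m T m≤T with c , lo , hi ← halve (T ∸ m) =
  c , ℕP.≤-trans (ℕP.+-monoˡ-≤ m lo) (ℕP.≤-trans (ℕP.≤-reflexive T∸m+m) (ℕP.n≤1+n T))
    , ℕP.≤-trans (ℕP.≤-reflexive (sym T∸m+m)) (ℕP.+-monoˡ-≤ m hi)
  where
  T∸m+m : T ∸ m + m ≡ T
  T∸m+m = ℕP.m∸n+n≡m m≤T

toℤ² : ℕ × ℕ → ℤ × ℤ
toℤ² (x , y) = + x , + y

toℤ²-injective : ∀ {p q} → toℤ² p ≡ toℤ² q → p ≡ q
toℤ²-injective e = cong₂ _,_ (ℤP.+-injective (cong proj₁ e)) (ℤP.+-injective (cong proj₂ e))

∈-⟦⟧ : ∀ a {i} → 0 < i → i ≤ a → + i ∈ ⟦ a ⟧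
∈-⟦⟧ a {suc i} _ i<a = ∈-map⁺ (λ j → + suc j) (∈-upTo⁺ i<a)

strip-achieves : ∀ ℓ a b → Σ ℕ λ k → bound ℓ a b ≤ k × Achievable ⟦ a ⟧ ⟦ b ⟧ ℓ k
strip-achieves ℓ a b =
  length Q , size , Q , unique , inside , (map +_ (interval c m) , |D|≤ℓ , on-diagonals) , refl
  where
  m = ℓ ⊓ (a + b)
  window = centred-window m (a + b + 3) (ℕP.≤-trans (ℕP.m⊓n≤n ℓ (a + b)) (ℕP.m≤m+n (a + b) 3))
  c = proj₁ window
  strip = filter (inStrip? c m) (grid 0 a b)
  Q = map toℤ² strip
  size : bound ℓ a b ≤ length Q
  size = ℕP.≤-trans (bound-⊓ ℓ (a + b) a b ℕP.≤-refl)
           (ℕP.≤-trans (strip-count 0 a b (proj₂ window)) (ℕP.≤-reflexive (sym (length-map toℤ² strip))))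
  unique : Unique Q
  unique = Unique.map⁺ toℤ²-injective (Unique.filter⁺ (inStrip? c m) (grid-unique 0 a b))
  inside : SubsetProd Q ⟦ a ⟧ ⟦ b ⟧
  inside = AllP.map⁺ (All.tabulate λ p∈ →
    let (0<x , x≤a) , (0<y , y≤b) = grid-in-box 0 a b (proj₁ (∈-filter⁻ (inStrip? c m) {xs = grid 0 a b} p∈))
    in ∈-⟦⟧ a 0<x x≤a , ∈-⟦⟧ b 0<y y≤b)
  |D|≤ℓ : length (map +_ (interval c m)) ≤ ℓ
  |D|≤ℓ = ℕP.≤-trans (ℕP.≤-reflexive (trans (length-map +_ (interval c m)) (length-interval c m))) (ℕP.m⊓n≤m ℓ (a + b))
  on-diagonals : All (λ p → diag p ∈ map +_ (interval c m)) Q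
  on-diagonals = AllP.map⁺ (All.tabulate λ p∈ →
    let c≤s , s<c+m = proj₂ (∈-filter⁻ (inStrip? c m) {xs = grid 0 a b} p∈)
    in ∈-map⁺ +_ (∈-interval⁺ c m c≤s s<c+m))

-- h(A, B, ℓ) ≤ h([a], [b], ℓ): both are squeezed around bound ℓ a b.
mainTheorem4 : (A B : List ℤ) → Unique A → Unique B → (ℓ : ℕ) →
    (k : ℕ) → Achievable A B ℓ k →
    Σ ℕ λ k′ → k ≤ k′ × Achievable ⟦ length A ⟧ ⟦ length B ⟧ ℓ k′
mainTheorem4 A B uA uB ℓ k (P , uP , sub , onD , |P|≡k) =
  k′ , subst (_≤ k′) |P|≡k (ℕP.≤-trans upper bound≤k′) , achieved
  where
  upper : length P ≤ bound ℓ (length A) (length B)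
  upper = upper-bound ℓ (length A) A B P refl uA uB uP sub onD
  lower = strip-achieves ℓ (length A) (length B)
  k′ = proj₁ lower
  bound≤k′ = proj₁ (proj₂ lower)
  achieved = proj₂ (proj₂ lower)
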